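{- Let $f(x,y)\in\mathbb{Z}[x,y]$ be a polynomial with no constant term. Then there are infinitely many pairs of positive integers $(x,y)$ for which $f(x,y)$ is not a prime number. -}

module Defs where

open import Data.Nat using (ℕ)
open import Data.Integer using (ℤ; _+_; _*_; _^_; +_)
open import Data.List using (List; []; _∷_)
open import Data.Product using (_×_; _,_)

-- A polynomial in ℤ[x,y], represented as a finite list of monomials
-- (c , i , j) standing for c · x^i · y^j.  Every element of ℤ[x,y] has
-- such a representation (duplicates / zero coefficients allowed).
Poly₂ : Set
Poly₂ = List (ℤ × ℕ × ℕ)

eval : Poly₂ → ℤ → ℤ → ℤ
eval []                  x y = + 0
eval ((c , i , j) ∷ ms) x y = c * (x ^ i) * (y ^ j) + eval ms x y

-- At x = y = m every monomial of f other than the constant one is a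
-- multiple of m, so f(m,m) ≡ f(0,0) = 0 (mod m).  A multiple of a composite
-- number cannot be prime, and composite m can be taken arbitrarily large.
module Submission where

open import Defs
open import Data.Nat using (ℕ; _<_; _+_)
open import Data.Nat.Primality using (Prime)
open import Data.Integer using (+_)
open import Data.Product using (∃-syntax; _×_)
open import Relation.Nullary using (¬_)
open import Relation.Binary.PropositionalEquality using (_≡_)

open import Data.List using ([]; _∷_)
open import Data.Product using (_,_)
open import Data.Nat as ℕ using (zero; suc; z<s)
open import Data.Nat.Properties using (m≤n*m; m≤m+n; <-≤-trans)
open import Data.Nat.Divisibility as ℕ using (m∣m*n)
open import Data.Nat.Primality
  using (Composite; composite-∣; composite⇒¬prime; composite[4]; prime⇒nonZero)
open import Data.Integer as ℤ using (ℤ; 0ℤ; 1ℤ; _-_; _*_; _^_)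
open import Data.Integer.Properties using (+-inverseʳ; +-identityʳ)
open import Data.Integer.Divisibility.Signed
  using (_∣_; divides; ∣m∣n⇒∣m+n; ∣m∣n⇒∣m-n; ∣m⇒∣m*n; ∣n⇒∣m*n; ∣⇒∣ᵤ; ∣-refl)
open import Data.Integer.Tactic.RingSolver using (solve-∀)
open import Relation.Binary.PropositionalEquality using (refl; subst; sym; trans; cong)

monomial : ℤ → ℕ → ℕ → ℤ → ℤ → ℤ
monomial c i j x y = c * x ^ i * y ^ j

∣0 : ∀ {a} → a ∣ 0ℤ
∣0 = divides 0ℤ refl

[m+n]-[o+p]≡[m-o]+[n-p] : ∀ m n o p → (m ℤ.+ n) - (o ℤ.+ p) ≡ (m - o) ℤ.+ (n - p)
[m+n]-[o+p]≡[m-o]+[n-p] = solve-∀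

module _ {a : ℤ} where

  ∣^suc : ∀ {x} i → a ∣ x → a ∣ x ^ suc i
  ∣^suc {x} i a∣x = ∣m⇒∣m*n (x ^ i) a∣x

  module _ {x y : ℤ} (a∣x : a ∣ x) (a∣y : a ∣ y) where

    ∣monomial-monomial[0,0] : ∀ c i j → a ∣ monomial c i j x y - monomial c i j 0ℤ 0ℤ
    ∣monomial-monomial[0,0] c zero zero =
      subst (a ∣_) (sym (+-inverseʳ (c * 1ℤ * 1ℤ))) ∣0
    ∣monomial-monomial[0,0] c (suc i) j = ∣m∣n⇒∣m-n
      (∣m⇒∣m*n (y ^ j) (∣n⇒∣m*n c (∣^suc i a∣x)))
      (∣m⇒∣m*n (0ℤ ^ j) (∣n⇒∣m*n c (∣^suc i ∣0)))
    ∣monomial-monomial[0,0] c zero (suc j) = ∣m∣n⇒∣m-n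
      (∣n⇒∣m*n (c * 1ℤ) (∣^suc j a∣y))
      (∣n⇒∣m*n (c * 1ℤ) (∣^suc j ∣0))

    ∣eval-eval[0,0] : ∀ f → a ∣ eval f x y - eval f 0ℤ 0ℤ
    ∣eval-eval[0,0] [] = ∣0
    ∣eval-eval[0,0] ((c , i , j) ∷ f) =
      subst (a ∣_) (sym ([m+n]-[o+p]≡[m-o]+[n-p]
        (monomial c i j x y) (eval f x y) (monomial c i j 0ℤ 0ℤ) (eval f 0ℤ 0ℤ)))
        (∣m∣n⇒∣m+n (∣monomial-monomial[0,0] c i j) (∣eval-eval[0,0] f))

∣eval[a,a] : ∀ f → eval f 0ℤ 0ℤ ≡ 0ℤ → ∀ a → a ∣ eval f a a
∣eval[a,a] f f[0,0]≡0 a = subst (a ∣_) f[a,a]-0≡f[a,a] (∣eval-eval[0,0] ∣-refl ∣-refl f)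
  where
  f[a,a]-0≡f[a,a] : eval f a a - eval f 0ℤ 0ℤ ≡ eval f a a
  f[a,a]-0≡f[a,a] = trans (cong (eval f a a -_) f[0,0]≡0) (+-identityʳ (eval f a a))

theorem1 : (f : Poly₂) → eval f (+ 0) (+ 0) ≡ + 0 →
    (N : ℕ) → ∃[ x ] ∃[ y ] (0 < x × 0 < y × N < x + y ×
      ¬ (∃[ p ] (Prime p × eval f (+ x) (+ y) ≡ + p)))
theorem1 f f[0,0]≡0 N = m , m , z<s , z<s , <-≤-trans N<m (m≤m+n m m) , f[m,m]-not-prime
  where
  m : ℕ
  m = 4 ℕ.* suc N

  N<m : N < m
  N<m = m≤n*m (suc N) 4

  m-composite : Composite m
  m-composite = composite-∣ composite[4] (m∣m*n (suc N))

  f[m,m]-not-prime : ¬ (∃[ p ] (Prime p × eval f (+ m) (+ m) ≡ + p))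
  f[m,m]-not-prime (p , p-prime , f[m,m]≡p) =
    composite⇒¬prime (composite-∣ ⦃ prime⇒nonZero p-prime ⦄ m-composite m∣p) p-prime
    where
    m∣p : m ℕ.∣ p
    m∣p = ∣⇒∣ᵤ (subst (+ m ∣_) f[m,m]≡p (∣eval[a,a] f f[0,0]≡0 (+ m)))
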